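{- Let $r\ge1$, $0\le k<r$, $\lambda\in\mathbb{Z}^{r+1}$ dominant, $\rho=(r,\dots,1,0)$, and $w=w_0^{(r-1)}\sigma_r\sigma_{r-1}\cdots\sigma_{r-k}$. For $\mu\in\mathbb{Z}^r$ interleaving with $\lambda+\rho$ let $\mathcal{C}_\mu$ be the set of Gelfand–Tsetlin patterns of rank $r$ with top row $\lambda+\rho$ and second row $\mu$. Then for each such $\mu$ either $\mathcal{C}_\mu\cap\mathcal{C}^{(w)}_{\lambda+\rho}=\emptyset$ or $\mathcal{C}_\mu\subseteq\mathcal{C}^{(w)}_{\lambda+\rho}$; moreover $\mathcal{C}_\mu\subseteq\mathcal{C}^{(w)}_{\lambda+\rho}$ if and only if $\mu_j=\lambda_{j+1}+r-j$ for all $j$ with $k+1<j\le r$; and $\mathcal{C}^{(w)}_{\lambda+\rho}=\bigcup_\mu\mathcal{C}_\mu$, the union over all $\mu$ interleaving with $\lambda+\rho$ with $\mu_j=\lambda_{j+1}+r-j$ for $j>k+1$.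
   Context: $S_{r+1}$ is generated by $\sigma_i=(i\ i+1)$. $w_0^{(m)}$ denotes the word $\sigma_1(\sigma_2\sigma_1)(\sigma_3\sigma_2\sigma_1)\cdots(\sigma_m\sigma_{m-1}\cdots\sigma_1)$ (a reduced expression of the longest element of $\langle\sigma_1,\dots,\sigma_m\rangle$; $w_0^{(0)}=1$); so $w$ is the prefix of length $\binom{r}{2}+k+1$ of $w_0^{(r)}$. $\mu\in\mathbb{Z}^r$ interleaves with $\lambda+\rho$ if $\lambda_1+r\ge\mu_1\ge\lambda_2+r-1\ge\mu_2\ge\dots\ge\lambda_r+1\ge\mu_r\ge\lambda_{r+1}$. A Gelfand–Tsetlin pattern of rank $r$ with top row $\kappa$ is an integer array $(a_{ij})_{0\le i\le j\le r}$ with top row $\kappa$ and $a_{i-1,j-1}\ge a_{ij}\ge a_{i-1,j}$; its $\Gamma$-array is $\Gamma_{ij}=\sum_{k'=j}^r(a_{ik'}-a_{i-1,k'})$; number its entries $b_{\binom{r-i+1}{2}+j-i+1}=\Gamma_{ij}$ ($1\le i\le j\le r$), giving $b_1,\dots,b_{\binom{r+1}{2}}$. The Demazure crystal $\mathcal{C}^{(w)}_{\lambda+\rho}$ for a prefix $w$ of $w_0^{(r)}$ is the set of patterns with top row $\lambda+\rho$ with $b_m=0$ for all $m>\ell(w)$. (These patterns are the vertices of the highest weight crystal $\mathcal{C}_{\lambda+\rho}$, $(b_m)$ being the Berenstein–Zelevinsky–Littelmann array along $w_0^{(r)}$; $\mathcal{C}_\mu$ is the connected component, of highest weight $\mu$,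 obtained after deleting all edges labelled $r$.) -}

module Defs where

open import Data.Nat as N using (ℕ; zero; suc; _∸_)
open import Data.Nat.Combinatorics using (_C_)
open import Data.Integer using (ℤ; +_; _+_; _-_; _≤_; 0ℤ)
open import Data.List using (List; []; _∷_; _++_; take; length)
open import Data.Product using (_×_; Σ; ∃)
open import Relation.Binary.PropositionalEquality using (_≡_)

-- Words in the generators σ_1, σ_2, … of S_{r+1}; a word is the list of
-- the indices i of its letters σ_i, read left to right.

descending : ℕ → List ℕ
descending zero    = []
descending (suc m) = suc m ∷ descending m

w₀ : ℕ → List ℕ
w₀ zero    = []
w₀ (suc m) = w₀ m ++ descending (suc m)

wordW : ℕ → ℕ → List ℕ
wordW r k = w₀ (r ∸ 1) ++ take (suc k) (descending r)

-- Vectors in ℤ^n are functions ℕ → ℤ indexed with the paper's indices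
-- 1,…,n (entries at other indices are irrelevant).

Dominant : ℕ → (ℕ → ℤ) → Set
Dominant r lam = ∀ j → 1 N.≤ j → j N.≤ r → lam (suc j) ≤ lam j

-- λ + ρ with ρ = (r, …, 1, 0), indexed as the top row a_{0j}, j = 0,…,r:
-- (λ+ρ)_j = λ_{j+1} + r - j
lamRho : ℕ → (ℕ → ℤ) → ℕ → ℤ
lamRho r lam j = lam (suc j) + + (r ∸ j)

Interleaves : ℕ → (ℕ → ℤ) → (ℕ → ℤ) → Set
Interleaves r lam μ =
  ∀ j → 1 N.≤ j → j N.≤ r →
    (μ j ≤ lam j + + (suc (r ∸ j))) × (lam (suc j) + + (r ∸ j) ≤ μ j)

-- Integer arrays (a_{ij}), only entries with 0 ≤ i ≤ j ≤ r are meaningful.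
Array : Set
Array = ℕ → ℕ → ℤ

IsGT : ℕ → (ℕ → ℤ) → Array → Set
IsGT r κ a =
  (∀ j → j N.≤ r → a 0 j ≡ κ j) ×
  (∀ i j → 1 N.≤ i → i N.≤ j → j N.≤ r →
     (a i j ≤ a (i ∸ 1) (j ∸ 1)) × (a (i ∸ 1) j ≤ a i j))

sumFrom : (ℕ → ℤ) → ℕ → ℕ → ℤ
sumFrom f j zero    = 0ℤ
sumFrom f j (suc n) = f j + sumFrom f (suc j) n

Γ : ℕ → Array → ℕ → ℕ → ℤ
Γ r a i j = sumFrom (λ k' → a i k' - a (i ∸ 1) k') j (suc r ∸ j)

-- b_m with m = binom(r-i+1,2) + j - i + 1 equals Γ_{ij}; the Demazure
-- crystal for a prefix of length ℓ: GT patterns with top row κ and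
-- b_m = 0 for all m > ℓ.
InDemazure : ℕ → (ℕ → ℤ) → ℕ → Array → Set
InDemazure r κ ℓ a =
  IsGT r κ a ×
  (∀ i j → 1 N.≤ i → i N.≤ j → j N.≤ r →
     ℓ N.< (suc (r ∸ i)) C 2 N.+ (j ∸ i) N.+ 1 → Γ r a i j ≡ 0ℤ)

InCμ : ℕ → (ℕ → ℤ) → (ℕ → ℤ) → Array → Set
InCμ r κ μ a = IsGT r κ a × (∀ j → 1 N.≤ j → j N.≤ r → a 1 j ≡ μ j)

InCw : ℕ → ℕ → (ℕ → ℤ) → Array → Set
InCw r k lam = InDemazure r (lamRho r lam) (length (wordW r k))

TailCond : ℕ → ℕ → (ℕ → ℤ) → (ℕ → ℤ) → Set
TailCond r k lam μ = ∀ j → suc (suc k) N.≤ j → j N.≤ r → μ j ≡ lamRho r lam j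

{-# OPTIONS --safe #-}
-- The word w has length binom(r,2) + k + 1, and the position binom(r-i+1,2) + j-i+1 of Γ_{ij}
-- exceeds it exactly when i = 1 and j ≥ k+2, so the Demazure condition only constrains the
-- first row of Γ. In a Gelfand–Tsetlin pattern the increments a_{1t} - a_{0t} are nonnegative,
-- hence Γ_{1j} = 0 for all j ≥ k+2 says precisely that the second row agrees with λ+ρ from
-- position k+2 on. Membership in C^{(w)} is thus a condition on the second row μ alone, which
-- gives all three claims; necessity for C_μ ⊆ C^{(w)} uses that C_μ is nonempty, as witnessed
-- by the pattern repeating μ in every row.
module Submission where

open import Defs
open import Data.Nat using (ℕ; _≤_; _<_)
open import Data.Integer using (ℤ)
open import Data.Product using (_×_; Σ)
open import Data.Sum using (_⊎_)
open import Function.Bundles using (_⇔_)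
open import Relation.Nullary using (¬_)

open import Data.Nat using (zero; suc; _+_; _∸_; _⊓_; z≤n; s≤s)
open import Data.Nat.Properties
  using ( _≤?_; ≤-refl; ≤-trans; ≤-reflexive; <-≤-trans; <-irrefl; m≤n⇒m≤1+n; n≤1+n; ≤-pred
        ; m≤n⇒m<n∨m≡n; m≤m+n; m<m+n; m≤n+m; +-identityʳ; +-comm; +-assoc; +-suc; +-∸-assoc
        ; +-cancelˡ-<; +-monoˡ-≤; +-monoʳ-≤; +-monoʳ-<; m+[n∸m]≡n; m∸n+n≡m; ∸-monoˡ-≤; m∸n≤m
        ; m≤n⇒m⊓n≡m; allUpTo?; module ≤-Reasoning )
open import Data.Nat.Combinatorics using (_C_; nC1≡n; nCk+nC[k+1]≡[n+1]C[k+1])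
open import Data.Integer as ℤ using (+_; 0ℤ)
import Data.Integer.Properties as ℤ
open import Data.List using (length; take; _++_)
open import Data.List.Properties using (length-++; length-take)
open import Data.Product using (_,_; proj₁; proj₂)
open import Data.Sum using (inj₁; inj₂)
open import Data.Empty using (⊥-elim)
open import Function.Bundles using (mk⇔; Equivalence)
open import Relation.Nullary using (Dec; yes; no)
open import Relation.Nullary.Decidable using (map′; _→-dec_)
open import Relation.Binary.PropositionalEquality
  using (_≡_; refl; sym; trans; cong; cong₂; subst; module ≡-Reasoning)
open Equivalence using (to; from)

length-descending : ∀ m → length (descending m) ≡ m
length-descending zero    = refl
length-descending (suc m) = cong suc (length-descending m)

C2-suc : ∀ n → suc n C 2 ≡ n + n C 2
C2-suc n = trans (sym (nCk+nC[k+1]≡[n+1]C[k+1] n 1)) (cong (_+ n C 2) (nC1≡n n))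

length-w₀ : ∀ m → length (w₀ m) ≡ suc m C 2
length-w₀ zero    = refl
length-w₀ (suc m) = begin
  length (w₀ m ++ descending (suc m))  ≡⟨ length-++ (w₀ m) ⟩
  length (w₀ m) + length (descending (suc m))
    ≡⟨ cong₂ _+_ (length-w₀ m) (length-descending (suc m)) ⟩
  suc m C 2 + suc m                    ≡⟨ +-comm (suc m C 2) (suc m) ⟩
  suc m + suc m C 2                    ≡⟨ sym (C2-suc (suc m)) ⟩
  suc (suc m) C 2                      ∎
  where open ≡-Reasoning

length-wordW : ∀ {r k} → k < r → length (wordW r k) ≡ r C 2 + suc k
length-wordW {suc r} {k} k<r = begin
  length (w₀ r ++ take (suc k) (descending (suc r)))
    ≡⟨ length-++ (w₀ r) ⟩
  length (w₀ r) + length (take (suc k) (descending (suc r)))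
    ≡⟨ cong₂ _+_ (length-w₀ r) (length-take (suc k) (descending (suc r))) ⟩
  suc r C 2 + (suc k ⊓ length (descending (suc r)))
    ≡⟨ cong (λ n → suc r C 2 + (suc k ⊓ n)) (length-descending (suc r)) ⟩
  suc r C 2 + (suc k ⊓ suc r)  ≡⟨ cong (_+_ (suc r C 2)) (m≤n⇒m⊓n≡m k<r) ⟩
  suc r C 2 + suc k            ∎
  where open ≡-Reasoning

C2-mono : ∀ {m n} → m ≤ n → m C 2 ≤ n C 2
C2-mono {m} {n} m≤n = subst (λ x → m C 2 ≤ x C 2) (m∸n+n≡m m≤n) (shift (n ∸ m))
  where
  shift : ∀ d → m C 2 ≤ (d + m) C 2
  shift zero    = ≤-refl
  shift (suc d) = ≤-trans (shift d)
    (subst ((d + m) C 2 ≤_) (sym (C2-suc (d + m))) (m≤n+m _ (d + m)))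

bzIndex : ℕ → ℕ → ℕ → ℕ
bzIndex r i j = suc (r ∸ i) C 2 + (j ∸ i) + 1

bzIndex-firstRow : ∀ r {j} → 1 ≤ j → bzIndex r 1 j ≡ r C 2 + j
bzIndex-firstRow zero    1≤j = m∸n+n≡m 1≤j
bzIndex-firstRow (suc r) 1≤j =
  trans (+-assoc (suc r C 2) _ 1) (cong (_+_ (suc r C 2)) (m∸n+n≡m 1≤j))

bzIndex-lowerRows : ∀ {r i j} → 2 ≤ i → i ≤ j → j ≤ r → bzIndex r i j ≤ r C 2
bzIndex-lowerRows {r} {i} {j} (s≤s (s≤s _)) i≤j j≤r = begin
  suc s C 2 + (j ∸ i) + 1  ≤⟨ +-monoˡ-≤ 1 (+-monoʳ-≤ (suc s C 2) (∸-monoˡ-≤ i j≤r)) ⟩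
  suc s C 2 + s + 1
    ≡⟨ trans (+-assoc (suc s C 2) s 1) (cong (_+_ (suc s C 2)) (+-comm s 1)) ⟩
  suc s C 2 + suc s        ≡⟨ trans (+-comm (suc s C 2) (suc s)) (sym (C2-suc (suc s))) ⟩
  suc (suc s) C 2          ≤⟨ C2-mono (two+r∸i≤r (≤-trans i≤j j≤r)) ⟩
  r C 2                    ∎
  where
  open ≤-Reasoning
  s = r ∸ i
  two+r∸i≤r : ∀ {r} → i ≤ r → suc (suc (r ∸ i)) ≤ r
  two+r∸i≤r {suc (suc r)} (s≤s (s≤s _)) = s≤s (s≤s (m∸n≤m r (i ∸ 2)))

beyondPrefix⇒firstRow : ∀ {r k i j} → 1 ≤ i → i ≤ j → j ≤ r →
  r C 2 + suc k < bzIndex r i j → i ≡ 1 × suc (suc k) ≤ j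
beyondPrefix⇒firstRow {r} {k} {suc zero} {j} _ 1≤j _ beyond =
  refl , +-cancelˡ-< (r C 2) (suc k) j (subst (r C 2 + suc k <_) (bzIndex-firstRow r 1≤j) beyond)
beyondPrefix⇒firstRow {r} {k} {suc (suc _)} _ i≤j j≤r beyond =
  ⊥-elim (<-irrefl refl (<-≤-trans beyond (≤-trans lowerRows (m≤m+n (r C 2) (suc k)))))
  where lowerRows = bzIndex-lowerRows (s≤s (s≤s z≤n)) i≤j j≤r

firstRow⇒beyondPrefix : ∀ {r k j} → suc (suc k) ≤ j → r C 2 + suc k < bzIndex r 1 j
firstRow⇒beyondPrefix {r} {k} {j} k+2≤j =
  subst (r C 2 + suc k <_) (sym (bzIndex-firstRow r (≤-trans (s≤s z≤n) k+2≤j)))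
        (+-monoʳ-< (r C 2) k+2≤j)

nonneg-+≡0 : ∀ {x y} → 0ℤ ℤ.≤ x → 0ℤ ℤ.≤ y → x ℤ.+ y ≡ 0ℤ → x ≡ 0ℤ × y ≡ 0ℤ
nonneg-+≡0 {x} {y} 0≤x 0≤y x+y≡0 = x≡0 , (begin
  y            ≡⟨ sym (ℤ.+-identityˡ y) ⟩
  0ℤ ℤ.+ y     ≡⟨ cong (ℤ._+ y) (sym x≡0) ⟩
  x ℤ.+ y      ≡⟨ x+y≡0 ⟩
  0ℤ           ∎)
  where
  open ≡-Reasoning
  x≤x+y : x ℤ.≤ x ℤ.+ y
  x≤x+y = subst (ℤ._≤ x ℤ.+ y) (ℤ.+-identityʳ x) (ℤ.+-monoʳ-≤ x 0≤y)
  x≡0 : x ≡ 0ℤ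
  x≡0 = ℤ.≤-antisym (subst (x ℤ.≤_) x+y≡0 x≤x+y) 0≤x

AllFrom : (ℕ → Set) → ℕ → ℕ → Set
AllFrom P j n = ∀ t → j ≤ t → t < j + n → P t

module _ {P : ℕ → Set} where

  AllFrom-head : ∀ {j n} → AllFrom P j (suc n) → P j
  AllFrom-head {j} all = all j ≤-refl (m<m+n j (s≤s z≤n))

  AllFrom-tail : ∀ {j n} → AllFrom P j (suc n) → AllFrom P (suc j) n
  AllFrom-tail {j} {n} all t j<t t<1+j+n =
    all t (≤-trans (n≤1+n j) j<t) (subst (t <_) (sym (+-suc j n)) t<1+j+n)

  AllFrom-cons : ∀ {j n} → P j → AllFrom P (suc j) n → AllFrom P j (suc n)
  AllFrom-cons {j} {n} Pj all t j≤t t<j+1+n with m≤n⇒m<n∨m≡n j≤t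
  ... | inj₁ j<t  = all t j<t (subst (t <_) (+-suc j n) t<j+1+n)
  ... | inj₂ refl = Pj

  AllFrom-upTo⇔ : ∀ {r j} → j ≤ suc r → AllFrom P j (suc r ∸ j) ⇔ (∀ t → j ≤ t → t ≤ r → P t)
  AllFrom-upTo⇔ {r} {j} j≤1+r = mk⇔
    (λ all t j≤t t≤r → all t j≤t (subst (t <_) (sym (m+[n∸m]≡n j≤1+r)) (s≤s t≤r)))
    (λ all t j≤t t<end → all t j≤t (≤-pred (subst (t <_) (m+[n∸m]≡n j≤1+r) t<end)))

module _ (f : ℕ → ℤ) where

  sumFrom-nonneg : ∀ j n → AllFrom (λ t → 0ℤ ℤ.≤ f t) j n → 0ℤ ℤ.≤ sumFrom f j n
  sumFrom-nonneg j zero    _   = ℤ.≤-refl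
  sumFrom-nonneg j (suc n) all =
    ℤ.+-mono-≤ (AllFrom-head all) (sumFrom-nonneg (suc j) n (AllFrom-tail all))

  sumFrom-zero : ∀ j n → AllFrom (λ t → f t ≡ 0ℤ) j n → sumFrom f j n ≡ 0ℤ
  sumFrom-zero j zero    _   = refl
  sumFrom-zero j (suc n) all =
    cong₂ ℤ._+_ (AllFrom-head all) (sumFrom-zero (suc j) n (AllFrom-tail all))

  sumFrom≡0⇒zero : ∀ j n → AllFrom (λ t → 0ℤ ℤ.≤ f t) j n →
    sumFrom f j n ≡ 0ℤ → AllFrom (λ t → f t ≡ 0ℤ) j n
  sumFrom≡0⇒zero j zero _ _ t j≤t t<j+0 =
    ⊥-elim (<-irrefl refl (<-≤-trans t<j+0 (≤-trans (≤-reflexive (+-identityʳ j)) j≤t)))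
  sumFrom≡0⇒zero j (suc n) nonneg sum≡0
    with nonneg-+≡0 (AllFrom-head nonneg) (sumFrom-nonneg (suc j) n (AllFrom-tail nonneg)) sum≡0
  ... | head≡0 , rest≡0 =
    AllFrom-cons head≡0 (sumFrom≡0⇒zero (suc j) n (AllFrom-tail nonneg) rest≡0)

Interlaces : ℕ → (ℕ → ℤ) → (ℕ → ℤ) → Set
Interlaces r κ μ = ∀ j → 1 ≤ j → j ≤ r → (κ j ℤ.≤ μ j) × (μ j ℤ.≤ κ (j ∸ 1))

module _ {r κ a} (gt : IsGT r κ a) where

  secondRow-interlaces : Interlaces r κ (a 1)
  secondRow-interlaces j 1≤j j≤r =
    subst (ℤ._≤ a 1 j) (proj₁ gt j j≤r) (proj₂ (proj₂ gt 1 j ≤-refl 1≤j j≤r)) ,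
    subst (a 1 j ℤ.≤_) (proj₁ gt (j ∸ 1) (≤-trans (m∸n≤m j 1) j≤r))
          (proj₁ (proj₂ gt 1 j ≤-refl 1≤j j≤r))

  Γ-firstRow≡0⇔ : ∀ {j} → 1 ≤ j → j ≤ r →
    Γ r a 1 j ≡ 0ℤ ⇔ (∀ t → j ≤ t → t ≤ r → a 1 t ≡ κ t)
  Γ-firstRow≡0⇔ {j} 1≤j j≤r = mk⇔
    (λ Γ≡0 t j≤t t≤r → trans (ℤ.i-j≡0⇒i≡j _ _ (to (AllFrom-upTo⇔ j≤1+r)
      (sumFrom≡0⇒zero increment j (suc r ∸ j) increments-nonneg Γ≡0) t j≤t t≤r)) (proj₁ gt t t≤r))
    (λ row → sumFrom-zero increment j (suc r ∸ j) (from (AllFrom-upTo⇔ j≤1+r)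
      (λ t j≤t t≤r → ℤ.i≡j⇒i-j≡0 (trans (row t j≤t t≤r) (sym (proj₁ gt t t≤r))))))
    where
    j≤1+r : j ≤ suc r
    j≤1+r = m≤n⇒m≤1+n j≤r
    increment : ℕ → ℤ
    increment t = a 1 t ℤ.- a 0 t
    increments-nonneg : AllFrom (λ t → 0ℤ ℤ.≤ increment t) j (suc r ∸ j)
    increments-nonneg = from (AllFrom-upTo⇔ j≤1+r) λ t j≤t t≤r → ℤ.i≤j⇒0≤j-i
      (subst (ℤ._≤ a 1 t) (sym (proj₁ gt t t≤r))
             (proj₁ (secondRow-interlaces t (≤-trans 1≤j j≤t) t≤r)))

inDemazure⇔ : ∀ {r k κ a} →
  InDemazure r κ (r C 2 + suc k) a ⇔
    (IsGT r κ a × (∀ j → suc (suc k) ≤ j → j ≤ r → a 1 j ≡ κ j))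
inDemazure⇔ {r} {k} {κ} {a} = mk⇔
  (λ (gt , vanish) → gt , λ j k+2≤j j≤r →
    let 1≤j = ≤-trans (s≤s z≤n) k+2≤j in
    to (Γ-firstRow≡0⇔ gt 1≤j j≤r)
       (vanish 1 j ≤-refl 1≤j j≤r (firstRow⇒beyondPrefix {r} k+2≤j)) j ≤-refl j≤r)
  (λ (gt , tail) → gt , vanishing gt tail)
  where
  vanishing : IsGT r κ a → (∀ j → suc (suc k) ≤ j → j ≤ r → a 1 j ≡ κ j) →
    ∀ i j → 1 ≤ i → i ≤ j → j ≤ r → r C 2 + suc k < bzIndex r i j → Γ r a i j ≡ 0ℤ
  vanishing gt tail i j 1≤i i≤j j≤r beyond with beyondPrefix⇒firstRow 1≤i i≤j j≤r beyond
  ... | refl , k+2≤j =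
    from (Γ-firstRow≡0⇔ gt i≤j j≤r) (λ t j≤t t≤r → tail t (≤-trans k+2≤j j≤t) t≤r)

inCw⇔ : ∀ {r k} lam {a} → k < r →
  InCw r k lam a ⇔ (IsGT r (lamRho r lam) a × TailCond r k lam (a 1))
inCw⇔ {r} {k} lam {a} k<r = subst (λ ℓ → InDemazure r κ ℓ a ⇔ (IsGT r κ a × TailCond r k lam (a 1)))
                                  (sym (length-wordW k<r)) inDemazure⇔
  where κ = lamRho r lam

lamRho-pred : ∀ {r} lam {j} → 1 ≤ j → j ≤ r → lamRho r lam (j ∸ 1) ≡ lam j ℤ.+ + suc (r ∸ j)
lamRho-pred {suc r} lam {suc j} _ (s≤s j≤r) = cong (λ n → lam (suc j) ℤ.+ + n) (+-∸-assoc 1 j≤r)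

interleaves⇔interlaces : ∀ {r} lam {μ} → Interleaves r lam μ ⇔ Interlaces r (lamRho r lam) μ
interleaves⇔interlaces lam {μ} = mk⇔
  (λ il j 1≤j j≤r →
    proj₂ (il j 1≤j j≤r) , subst (μ j ℤ.≤_) (sym (lamRho-pred lam 1≤j j≤r)) (proj₁ (il j 1≤j j≤r)))
  (λ il j 1≤j j≤r →
    subst (μ j ℤ.≤_) (lamRho-pred lam 1≤j j≤r) (proj₂ (il j 1≤j j≤r)) , proj₁ (il j 1≤j j≤r))

-- Row i consists of the entries a_{ii}, …, a_{ir}; here it is (μ_i, …, μ_r), and consecutive
-- truncations of μ interlace because μ is weakly decreasing.
repeatedRowPattern : (ℕ → ℤ) → (ℕ → ℤ) → Array
repeatedRowPattern κ μ zero    = κ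
repeatedRowPattern κ μ (suc _) = μ

repeatedRowPattern-isGT : ∀ {r κ μ} → Interlaces r κ μ → IsGT r κ (repeatedRowPattern κ μ)
repeatedRowPattern-isGT {r} {κ} {μ} il = (λ _ _ → refl) , between
  where
  pattern′ = repeatedRowPattern κ μ
  between : ∀ i j → 1 ≤ i → i ≤ j → j ≤ r →
    (pattern′ i j ℤ.≤ pattern′ (i ∸ 1) (j ∸ 1)) × (pattern′ (i ∸ 1) j ℤ.≤ pattern′ i j)
  between (suc zero)    j       _ 1≤j       j≤r = proj₂ (il j 1≤j j≤r) , proj₁ (il j 1≤j j≤r)
  between (suc (suc _)) (suc j) _ (s≤s i<j) j≤r =
    ℤ.≤-trans (proj₂ (il (suc j) (s≤s z≤n) j≤r))
              (proj₁ (il j (≤-trans (s≤s z≤n) i<j) (≤-trans (n≤1+n j) j≤r))) ,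
    ℤ.≤-refl

tailCond? : ∀ r k lam μ → Dec (TailCond r k lam μ)
tailCond? r k lam μ = map′
  (λ all j k+2≤j j≤r → all (s≤s j≤r) k+2≤j)
  (λ tail {j} j<1+r k+2≤j → tail j k+2≤j (≤-pred j<1+r))
  (allUpTo? (λ j → suc (suc k) ≤? j →-dec (μ j ℤ.≟ lamRho r lam j)) (suc r))

module _ {r k : ℕ} (k<r : k < r) (lam : ℕ → ℤ) where

  Cμ∩Cw⇒tailCond : ∀ {μ a} → InCμ r (lamRho r lam) μ a → InCw r k lam a → TailCond r k lam μ
  Cμ∩Cw⇒tailCond (_ , row) cw j k+2≤j j≤r =
    trans (sym (row j (≤-trans (s≤s z≤n) k+2≤j) j≤r)) (proj₂ (to (inCw⇔ lam k<r) cw) j k+2≤j j≤r)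

  tailCond⇒Cμ⊆Cw : ∀ {μ a} → TailCond r k lam μ → InCμ r (lamRho r lam) μ a → InCw r k lam a
  tailCond⇒Cμ⊆Cw tail (gt , row) = from (inCw⇔ lam k<r)
    (gt , λ j k+2≤j j≤r → trans (row j (≤-trans (s≤s z≤n) k+2≤j) j≤r) (tail j k+2≤j j≤r))

  Cμ-disjoint-or-⊆Cw : ∀ μ →
    ((a : Array) → ¬ (InCμ r (lamRho r lam) μ a × InCw r k lam a))
      ⊎ ((a : Array) → InCμ r (lamRho r lam) μ a → InCw r k lam a)
  Cμ-disjoint-or-⊆Cw μ with tailCond? r k lam μ
  ... | yes tail = inj₂ λ _ → tailCond⇒Cμ⊆Cw tail
  ... | no ¬tail = inj₁ λ _ (cμ , cw) → ¬tail (Cμ∩Cw⇒tailCond cμ cw)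

  Cμ⊆Cw⇔tailCond : ∀ {μ} → Interleaves r lam μ →
    ((a : Array) → InCμ r (lamRho r lam) μ a → InCw r k lam a) ⇔ TailCond r k lam μ
  Cμ⊆Cw⇔tailCond {μ} il = mk⇔
    (λ Cμ⊆Cw → Cμ∩Cw⇒tailCond witness (Cμ⊆Cw _ witness))
    (λ tail _ → tailCond⇒Cμ⊆Cw tail)
    where
    witness : InCμ r (lamRho r lam) μ (repeatedRowPattern (lamRho r lam) μ)
    witness = repeatedRowPattern-isGT (to (interleaves⇔interlaces lam) il) , λ _ _ _ → refl

  Cw⇔⋃Cμ : ∀ a → InCw r k lam a ⇔
    Σ (ℕ → ℤ) (λ μ → Interleaves r lam μ × TailCond r k lam μ × InCμ r (lamRho r lam) μ a)
  Cw⇔⋃Cμ a = mk⇔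
    (λ cw → let (gt , tail) = to (inCw⇔ lam k<r) cw in
      a 1 , from (interleaves⇔interlaces lam) (secondRow-interlaces gt) , tail , gt , λ _ _ _ → refl)
    (λ (_ , _ , tail , cμ) → tailCond⇒Cμ⊆Cw tail cμ)

proposition6p5 : (r : ℕ) → 1 ≤ r → (k : ℕ) → k < r →
    (lam : ℕ → ℤ) → Dominant r lam →
    ((μ : ℕ → ℤ) → Interleaves r lam μ →
      (((a : Array) → ¬ (InCμ r (lamRho r lam) μ a × InCw r k lam a))
        ⊎ ((a : Array) → InCμ r (lamRho r lam) μ a → InCw r k lam a))
      × (((a : Array) → InCμ r (lamRho r lam) μ a → InCw r k lam a)
          ⇔ TailCond r k lam μ))
    × ((a : Array) →
        InCw r k lam a
        ⇔ Σ (ℕ → ℤ) (λ μ → Interleaves r lam μ × TailCond r k lam μ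
                              × InCμ r (lamRho r lam) μ a))
proposition6p5 r _ k k<r lam _ =
  (λ μ il → Cμ-disjoint-or-⊆Cw k<r lam μ , Cμ⊆Cw⇔tailCond k<r lam il) , Cw⇔⋃Cμ k<r lam
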